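{- Let $n,m$ be positive integers with $n\ge 2$ and $m\ge 6$. Then $K_n\times K_m$ admits a barbell partition.
   Context: $K_n$ is the complete graph on $n$ vertices. $G\times H$ (tensor product) has vertex set $V(G)\times V(H)$, with $(g_1,h_1)(g_2,h_2)$ an edge iff $g_1g_2\in E(G)$ and $h_1h_2\in E(H)$. A barbell partition of a graph $K$ is a partition of $V(K)$ into three disjoint sets $\{R,W_1,W_2\}$ with $W_1,W_2\neq\emptyset$ ($R$ may be empty), no edges between $W_1$ and $W_2$, and $|N_K(r)\cap W_i|\neq 1$ for all $r\in R$, $i\in\{1,2\}$. -}

module Defs where

open import Data.Nat using (ℕ)
open import Data.Fin using (Fin)
open import Data.Fin.Properties using (_≟_)
open import Data.Product using (_×_; _,_; ∃)
open import Data.List using (List; filter; length; allFin; cartesianProduct)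
open import Data.Empty using (⊥)
open import Relation.Nullary using (¬_; Dec; yes; no)
open import Relation.Nullary.Decidable using (¬?; _×-dec_)
open import Relation.Binary.PropositionalEquality using (_≡_; _≢_)

record FinGraph : Set₁ where
  field
    V     : Set
    verts : List V              -- enumeration of V (duplicate-free, complete)
    Adj   : V → V → Set
    adj?  : ∀ u v → Dec (Adj u v)

open FinGraph public

K : ℕ → FinGraph
K n = record
  { V = Fin n
  ; verts = allFin n
  ; Adj = λ u v → ¬ (u ≡ v)
  ; adj? = λ u v → ¬? (u ≟ v)
  }

_⊗_ : FinGraph → FinGraph → FinGraph
G ⊗ H = record
  { V = V G × V H
  ; verts = cartesianProduct (verts G) (verts H)
  ; Adj = λ { (g₁ , h₁) (g₂ , h₂) → Adj G g₁ g₂ × Adj H h₁ h₂ }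
  ; adj? = λ { (g₁ , h₁) (g₂ , h₂) → adj? G g₁ g₂ ×-dec adj? H h₁ h₂ }
  }

data Part : Set where
  R W₁ W₂ : Part

_≟P_ : (a b : Part) → Dec (a ≡ b)
R  ≟P R  = yes _≡_.refl
R  ≟P W₁ = no λ ()
R  ≟P W₂ = no λ ()
W₁ ≟P R  = no λ ()
W₁ ≟P W₁ = yes _≡_.refl
W₁ ≟P W₂ = no λ ()
W₂ ≟P R  = no λ ()
W₂ ≟P W₁ = no λ ()
W₂ ≟P W₂ = yes _≡_.refl

nbrCount : (K : FinGraph) → (V K → Part) → V K → Part → ℕ
nbrCount K p v w = length (filter (λ u → adj? K v u ×-dec (p u ≟P w)) (verts K))

record IsBarbell (K : FinGraph) (p : V K → Part) : Set where
  field
    W₁-nonempty : ∃ λ v → p v ≡ W₁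
    W₂-nonempty : ∃ λ v → p v ≡ W₂
    no-edges    : ∀ u v → p u ≡ W₁ → p v ≡ W₂ → ¬ Adj K u v
    R-cond₁     : ∀ r → p r ≡ R → nbrCount K p r W₁ ≢ 1
    R-cond₂     : ∀ r → p r ≡ R → nbrCount K p r W₂ ≢ 1

HasBarbellPartition : FinGraph → Set
HasBarbellPartition K = ∃ λ (p : V K → Part) → IsBarbell K p

-- Put W₁ and W₂ on a single row of K n ⊗ K m, each on three columns, and
-- everything else in R. Two vertices of one row are never adjacent, so there
-- are no W₁–W₂ edges and an R-vertex of that row sees no Wᵢ at all; an
-- R-vertex (g , h) of another row is adjacent to every (0 , c) with c ≠ h,
-- hence to at least two of the three Wᵢ-columns.
module Submission where

open import Defs
open import Data.Nat using (ℕ; _≤_; _+_; suc; s≤s)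
open import Data.Fin using (Fin) renaming (zero to fz; suc to fs)
open import Data.Fin.Properties using () renaming (_≟_ to _≟F_)
open import Data.Product using (_×_; _,_; ∃₂; proj₁)
open import Data.List using (List; []; _∷_; filter; length)
open import Data.List.Properties using (filter-none)
open import Data.List.Membership.Propositional using (_∈_)
open import Data.List.Membership.Propositional.Properties
  using (∈-filter⁺; ∈-cartesianProduct⁺; ∈-allFin)
open import Data.List.Relation.Unary.All as All using ()
open import Data.List.Relation.Unary.Any using (here)
open import Relation.Nullary using (¬_; yes; no; _×-dec_)
open import Relation.Unary using (Decidable)
open import Relation.Binary.Definitions using (DecidableEquality)
open import Relation.Binary.PropositionalEquality
  using (_≡_; _≢_; refl; sym; trans; cong; ≢-sym)

module _ {A : Set} {P : A → Set} (P? : Decidable P) {xs : List A} where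

  length-filter≢1-of-none : (∀ {x} → x ∈ xs → ¬ P x) → length (filter P? xs) ≢ 1
  length-filter≢1-of-none none eq
    with () ← trans (sym (cong length (filter-none P? (All.tabulate none)))) eq

  length-filter≢1-of-two : ∀ {x y} → x ≢ y → x ∈ xs → y ∈ xs → P x → P y →
                           length (filter P? xs) ≢ 1
  length-filter≢1-of-two x≢y x∈ y∈ px py eq
    with filter P? xs | ∈-filter⁺ P? x∈ px | ∈-filter⁺ P? y∈ py
  ... | _ ∷ [] | here x≡z | here y≡z = x≢y (trans x≡z (sym y≡z))

TwoAvoiding : {A : Set} → (A → Set) → A → Set
TwoAvoiding P h = ∃₂ λ x y → x ≢ y × x ≢ h × y ≢ h × P x × P y

two-avoiding-of-three : {A : Set} {P : A → Set} → DecidableEquality A →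
                        ∀ {a b c} → a ≢ b → a ≢ c → b ≢ c →
                        P a → P b → P c → ∀ h → TwoAvoiding P h
two-avoiding-of-three _≟_ {a} {b} {c} a≢b a≢c b≢c pa pb pc h with h ≟ a | h ≟ b
... | yes refl | _        = b , c , b≢c , ≢-sym a≢b , ≢-sym a≢c , pb , pc
... | no h≢a   | yes refl = a , c , a≢c , a≢b , ≢-sym b≢c , pa , pc
... | no h≢a   | no h≢b   = a , b , a≢b , ≢-sym h≢a , ≢-sym h≢b , pa , pb

ThreeColumns : {m : ℕ} → (Fin m → Part) → Part → Set
ThreeColumns {m} col w =
  ∃₂ λ (a b : Fin m) → ∃₂ λ (c : Fin m) (_ : a ≢ b × a ≢ c × b ≢ c) →
    col a ≡ w × col b ≡ w × col c ≡ w

module OnFirstRow {n m : ℕ} (col : Fin m → Part) where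

  G : FinGraph
  G = K (suc n) ⊗ K m

  label : V G → Part
  label (fz   , h) = col h
  label (fs _ , _) = R

  first-row-of-≢R : ∀ u → label u ≢ R → proj₁ u ≡ fz
  first-row-of-≢R (fz   , _) _    = refl
  first-row-of-≢R (fs _ , _) u≢R with () ← u≢R refl

  first-row-of-≡ : ∀ {u w} → w ≢ R → label u ≡ w → proj₁ u ≡ fz
  first-row-of-≡ {u} w≢R u≡w = first-row-of-≢R u (λ u≡R → w≢R (trans (sym u≡w) u≡R))

  ∈-verts : ∀ u → u ∈ verts G
  ∈-verts (g , h) = ∈-cartesianProduct⁺ (∈-allFin g) (∈-allFin h)

  no-edges : ∀ u v → label u ≡ W₁ → label v ≡ W₂ → ¬ Adj G u v
  no-edges u v u≡W₁ v≡W₂ (rows-differ , _) =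
    rows-differ (trans (first-row-of-≡ (λ ()) u≡W₁) (sym (first-row-of-≡ (λ ()) v≡W₂)))

  nbrCount≢1 : ∀ w → w ≢ R → ThreeColumns col w →
               ∀ r → label r ≡ R → nbrCount G label r w ≢ 1
  nbrCount≢1 w w≢R _ (fz , h) _ =
    length-filter≢1-of-none P? {verts G} λ {u} _ ((rows-differ , _) , u≡w) →
      rows-differ (sym (first-row-of-≡ w≢R u≡w))
    where P? = λ u → adj? G (fz , h) u ×-dec (label u ≟P w)
  nbrCount≢1 w _ (a , b , c , (a≢b , a≢c , b≢c) , ca , cb , cc) (fs g , h) _
    with x , y , x≢y , x≢h , y≢h , cx , cy
           ← two-avoiding-of-three _≟F_ a≢b a≢c b≢c ca cb cc h =
    length-filter≢1-of-two P? {verts G} (λ { refl → x≢y refl })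
      (∈-verts (fz , x)) (∈-verts (fz , y))
      (((λ ()) , ≢-sym x≢h) , cx) (((λ ()) , ≢-sym y≢h) , cy)
    where P? = λ u → adj? G (fs g , h) u ×-dec (label u ≟P w)

  isBarbell : ThreeColumns col W₁ → ThreeColumns col W₂ → IsBarbell G label
  isBarbell three₁@(a₁ , _ , _ , _ , ca₁ , _) three₂@(a₂ , _ , _ , _ , ca₂ , _) = record
    { W₁-nonempty = (fz , a₁) , ca₁
    ; W₂-nonempty = (fz , a₂) , ca₂
    ; no-edges    = no-edges
    ; R-cond₁     = nbrCount≢1 W₁ (λ ()) three₁
    ; R-cond₂     = nbrCount≢1 W₂ (λ ()) three₂
    }

sixColumns : {k : ℕ} → Fin (6 + k) → Part
sixColumns fz                               = W₁
sixColumns (fs fz)                          = W₁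
sixColumns (fs (fs fz))                     = W₁
sixColumns (fs (fs (fs fz)))                = W₂
sixColumns (fs (fs (fs (fs fz))))           = W₂
sixColumns (fs (fs (fs (fs (fs fz)))))      = W₂
sixColumns (fs (fs (fs (fs (fs (fs _))))))  = R

threeColumns-W₁ : ∀ {k} → ThreeColumns (sixColumns {k}) W₁
threeColumns-W₁ = fz , fs fz , fs (fs fz) , ((λ ()) , (λ ()) , (λ ())) , refl , refl , refl

threeColumns-W₂ : ∀ {k} → ThreeColumns (sixColumns {k}) W₂
threeColumns-W₂ =
  fs (fs (fs fz)) , fs (fs (fs (fs fz))) , fs (fs (fs (fs (fs fz)))) ,
  ((λ ()) , (λ ()) , (λ ())) , refl , refl , refl

mainTheorem19 : (n m : ℕ) → 2 ≤ n → 6 ≤ m → HasBarbellPartition (K n ⊗ K m)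
mainTheorem19 (suc n) (suc (suc (suc (suc (suc (suc k)))))) (s≤s _) (s≤s (s≤s (s≤s (s≤s (s≤s (s≤s _)))))) =
  label , isBarbell threeColumns-W₁ threeColumns-W₂
  where open OnFirstRow {n} {6 + k} sixColumns
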